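{- Let $p$ be a prime, $r\ge1$, $\alpha_1,\dots,\alpha_r\ge1$ integers, $m\ge1$ an integer, and let $A=\mathbb{Z}_{p^{\alpha_1}}\oplus\cdots\oplus\mathbb{Z}_{p^{\alpha_r}}$ (direct product of rings). Then $\mathsf{D}_m(A)\le U(p^{\alpha_1},\dots,p^{\alpha_r};m)$.
   Context: For a finite commutative ring $A$, a sequence over $A$ is a finite multiset $S=(a_1,\dots,a_\ell)$ of elements of $A$; its length $|S|=\ell$ counts multiplicity, and a subsequence is a sub-multiset. For $m\ge1$, $e_m(S)=\sum_{1\le i_1<\dots<i_m\le \ell}\prod_{j=1}^m a_{i_j}$. $\mathsf{D}_m(A)$ is the smallest positive integer $t$ such that every sequence $S$ over $A$ with $|S|\ge t$ contains a subsequence $S'$ with $|S'|\ge m$ and $e_m(S')=0$. The ring $A$ has componentwise addition and multiplication. $U(p^{\alpha_1},\dots,p^{\alpha_r};m)$ is the smallest integer $t\ge m\sum_{i=1}^r(p^{\alpha_i}-1)+1$ such that $\sum_{0\le 2j\le m-1}\binom{t}{2j}\not\equiv\sum_{1\le 2j+1\le m-1}\binom{t}{2j+1}\pmod p$ (equivalently, such that $\binom{t-1}{m-1}\not\equiv0\pmod p$). -}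

module Defs where

open import Data.Nat using (ℕ; zero; suc; _+_; _*_; _∸_; _^_; _≤_; _<_)
open import Data.Nat.Divisibility using (_∣_)
open import Data.Nat.DivMod using (_%_)
open import Data.Nat.Combinatorics using (_C_)
open import Data.Nat.Primality using (Prime)
open import Data.Fin using (Fin; toℕ)
open import Data.List using (List; []; _∷_; map; allFin; length; upTo)
open import Data.Nat.ListAction using (sum)
open import Data.List.Relation.Binary.Sublist.Propositional using (_⊆_)
open import Data.Bool using (Bool; true; false; if_then_else_)
open import Data.Product using (Σ; _×_)
open import Relation.Binary.PropositionalEquality using (_≢_)
open import Relation.Nullary using (¬_)

esym : ℕ → List ℕ → ℕ
esym zero    _        = 1
esym (suc m) []       = 0
esym (suc m) (x ∷ xs) = x * esym m xs + esym (suc m) xs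

Elem : (p r : ℕ) → (Fin r → ℕ) → Set
Elem p r α = (i : Fin r) → Fin (p ^ α i)

-- e_m(S) = 0 in A: in every component i, the integer e_m of the
-- representatives is divisible by p ^ α i (ring ops in Z_{p^k} are reduction
-- of integer ops, and e_m is a polynomial).
EmZero : (p r : ℕ) (α : Fin r → ℕ) → ℕ → List (Elem p r α) → Set
EmZero p r α m S = (i : Fin r) → (p ^ α i) ∣ esym m (map (λ a → toℕ (a i)) S)

-- "every sequence over A of length ≥ t has a subsequence S' with |S'| ≥ m
-- and e_m(S') = 0"  (so D_m(A) ≤ t iff this holds; sub-multisets are
-- represented by sublists, e_m being symmetric)
DmBound : (p r : ℕ) (α : Fin r → ℕ) → ℕ → ℕ → Set
DmBound p r α m t =
  (S : List (Elem p r α)) → t ≤ length S →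
  Σ (List (Elem p r α)) λ S′ → (S′ ⊆ S) × (m ≤ length S′) × EmZero p r α m S′

isEven : ℕ → Bool
isEven zero = true
isEven (suc zero) = false
isEven (suc (suc n)) = isEven n

evenSum : ℕ → ℕ → ℕ
evenSum t m = sum (map (λ k → if isEven k then t C k else 0) (upTo m))

oddSum : ℕ → ℕ → ℕ
oddSum t m = sum (map (λ k → if isEven k then 0 else t C k) (upTo m))

ULower : (p r : ℕ) (α : Fin r → ℕ) → ℕ → ℕ
ULower p r α m = m * sum (map (λ i → p ^ α i ∸ 1) (allFin r)) + 1

-- t satisfies the defining condition of U (p prime, so p ≠ 0)
UCond : (p r : ℕ) (α : Fin r → ℕ) → ℕ → ℕ → Set
UCond p r α m t = ULower p r α m ≤ t × (evenSum t m % suc (p ∸ 1) ≢ oddSum t m % suc (p ∸ 1))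

IsU : (p r : ℕ) (α : Fin r → ℕ) → ℕ → ℕ → Set
IsU p r α m t = UCond p r α m t × ((t′ : ℕ) → t′ < t → ¬ UCond p r α m t′)

-- Write p = 1 + d, qᵢ = p^{αᵢ}, and let T be the first U terms of S. Since p ∣ C(qᵢ, k) for
-- 0 < k < qᵢ, the truncated alternating sum h_q(g) = Σ_{k<q} (-1)^k C(g, k) is q-periodic in g
-- modulo p; as h_q(0) = 1 and h_q(g) = 0 for 0 < g < q, h_q(g) ≡ [q ∣ g]. If no subsequence T_I
-- with |I| ≥ m had e_m(T_I) = 0, then F(I) = ∏ᵢ h_{qᵢ}(e_m(T_I)ᵢ) ≡ [|I| < m] (mod p) for every
-- I ⊆ T. Now F is a polynomial of degree ≤ m Σᵢ (qᵢ - 1) < U in the indicator variables of I,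
-- so its alternating sum over all I vanishes, while that of [|I| < m] is Σ_{k<m} (-1)^k C(U, k),
-- which is nonzero modulo p by the choice of U.

module Submission where

open import Algebra.Properties.CommutativeSemigroup using (interchange)
open import Data.Bool using (true; false; if_then_else_; not)
open import Data.Fin using (Fin; toℕ)
open import Data.Fin.Properties using (all?; ¬∀⟶∃¬)
open import Data.Fin.Subset using (Subset; inside; outside; ∣_∣; _∪_) renaming (⊥ to ∅)
open import Data.Fin.Subset.Properties using (∣⊥∣≡0; anySubset?)
open import Data.List using (List; []; _∷_; map; _++_; length; allFin; upTo; take; foldr)
open import Data.List.Properties using (upTo-∷ʳ; map-++; length-map; map-cong; length-take)
open import Data.List.Membership.Propositional.Properties using (∈-allFin; ∈-map⁺)
open import Data.List.Relation.Binary.Sublist.Propositional using (_⊆_; []; _∷_; _∷ʳ_; ⊆-trans)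
open import Data.List.Relation.Binary.Sublist.Propositional.Properties using (take-⊆)
open import Data.List.Relation.Unary.All as All using (All; []; _∷_)
open import Data.List.Relation.Unary.All.Properties using (++⁺; map⁺)
open import Data.Nat using (ℕ; zero; suc; _+_; _*_; _∸_; _^_; _≤_; _<_; _<ᵇ_; _%_; _/_; s≤s; z≤n; NonZero)
open import Data.Nat.Properties
open import Data.Nat.Combinatorics using (_C_; nCk+nC[k+1]≡[n+1]C[k+1]; nC1≡n; k>n⇒nCk≡0)
open import Data.Nat.DivMod using (%-distribˡ-+; %-distribˡ-*; m≡m%n+[m/n]*n; m%n<n)
open import Data.Nat.Divisibility
open import Data.Nat.ListAction using (sum; product)
open import Data.Nat.ListAction.Properties using (sum-++; ∈⇒∣product)
open import Data.Nat.Primality using (Prime; euclidsLemma; prime⇒nonZero; ¬prime[0])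
open import Data.Nat.Tactic.RingSolver using (solve-∀)
open import Data.Product using (_,_)
open import Data.Sum using (_⊎_; inj₁; inj₂)
open import Data.Vec using ([]; _∷_)
open import Function using (_∘_)
open import Relation.Binary.Bundles using (Setoid)
open import Relation.Binary.Structures using (IsEquivalence)
import Relation.Binary.Reasoning.Setoid as SetoidReasoning
open import Relation.Nullary using (¬_; Dec; yes; no; contradiction)
open import Relation.Nullary.Decidable using (_×-dec_)
open import Relation.Binary.PropositionalEquality
open import Defs

private variable n a b : ℕ

pascal : ∀ n k → suc n C suc k ≡ n C k + n C suc k
pascal n k = sym (nCk+nC[k+1]≡[n+1]C[k+1] n k)

C-absorption : ∀ n k → suc k * (suc n C suc k) ≡ suc n * (n C k)
C-absorption zero    zero    = refl
C-absorption zero    (suc k) = *-zeroʳ (2 + k)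
C-absorption (suc n) zero    = trans (+-identityʳ _) (trans (nC1≡n (2 + n)) (sym (*-identityʳ (2 + n))))
C-absorption (suc n) (suc k) = begin
  suc (suc k) * (suc (suc n) C suc (suc k))           ≡⟨ cong (suc (suc k) *_) (pascal (suc n) (suc k)) ⟩
  suc (suc k) * (u + v)                               ≡⟨ spread (suc k) u v ⟩
  suc k * u + u + suc (suc k) * v                     ≡⟨ cong₂ (λ x y → x + u + y) (C-absorption n k) (C-absorption n (suc k)) ⟩
  suc n * (n C k) + u + suc n * (n C suc k)           ≡⟨ collect (suc n) (n C k) (n C suc k) u ⟩
  suc n * (n C k + n C suc k) + u                     ≡⟨ cong (λ x → suc n * x + u) (sym (pascal n k)) ⟩
  suc n * u + u                                       ≡⟨ +-comm (suc n * u) u ⟩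
  suc (suc n) * u                                     ∎
  where
  open ≡-Reasoning
  u v : ℕ
  u = suc n C suc k
  v = suc n C suc (suc k)
  spread : ∀ k x y → suc k * (x + y) ≡ k * x + x + suc k * y
  spread = solve-∀
  collect : ∀ n x y z → n * x + z + n * y ≡ n * (x + y) + z
  collect = solve-∀

q∣[1+k]*qC[1+k] : ∀ q k → q ∣ suc k * (q C suc k)
q∣[1+k]*qC[1+k] zero    k = subst (0 ∣_) (sym (*-zeroʳ (suc k))) (∣-refl)
q∣[1+k]*qC[1+k] (suc q) k = divides (q C k) (trans (C-absorption q k) (*-comm (suc q) (q C k)))

module _ {p : ℕ} (p-prime : Prime p) where

  private instance
    p≢0 : NonZero p
    p≢0 = prime⇒nonZero p-prime

  p^a∣k*c∧p^a∤k⇒p∣c : ∀ a k c → p ^ a ∣ k * c → ¬ (p ^ a ∣ k) → p ∣ c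
  p^a∣k*c∧p^a∤k⇒p∣c zero    k c _ 1∤k = contradiction (1∣ k) 1∤k
  p^a∣k*c∧p^a∤k⇒p∣c (suc a) k c p^[1+a]∣kc p^[1+a]∤k
    with euclidsLemma k c p-prime (∣-trans (m∣m*n (p ^ a)) p^[1+a]∣kc)
  ... | inj₂ p∣c = p∣c
  ... | inj₁ (divides j refl) = p^a∣k*c∧p^a∤k⇒p∣c a j c p^a∣jc p^a∤j
    where
    p^a∣jc : p ^ a ∣ j * c
    p^a∣jc = *-cancelˡ-∣ p (subst (p * p ^ a ∣_) (reassoc j p c) p^[1+a]∣kc)
      where
      reassoc : ∀ j p c → j * p * c ≡ p * (j * c)
      reassoc = solve-∀
    p^a∤j : ¬ (p ^ a ∣ j)
    p^a∤j p^a∣j = p^[1+a]∤k (subst (p * p ^ a ∣_) (*-comm p j) (*-monoʳ-∣ p p^a∣j))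

  p∣[p^a]C[1+k] : ∀ a k → suc k < p ^ a → p ∣ (p ^ a) C suc k
  p∣[p^a]C[1+k] a k 1+k<p^a =
    p^a∣k*c∧p^a∤k⇒p∣c a (suc k) _ (q∣[1+k]*qC[1+k] (p ^ a) k) (λ p^a∣1+k → <⇒≱ 1+k<p^a (∣⇒≤ p^a∣1+k))

isEven-suc : ∀ m → isEven (suc m) ≡ not (isEven m)
isEven-suc zero          = refl
isEven-suc (suc zero)    = refl
isEven-suc (suc (suc m)) = isEven-suc m

evens odds : ℕ → ℕ → ℕ
evens n zero    = 0
evens n (suc m) = evens n m + (if isEven m then n C m else 0)
odds  n zero    = 0
odds  n (suc m) = odds n m + (if isEven m then 0 else n C m)

sum-upTo-suc : ∀ (f : ℕ → ℕ) m → sum (map f (upTo (suc m))) ≡ sum (map f (upTo m)) + f m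
sum-upTo-suc f m = begin
  sum (map f (upTo (suc m)))           ≡⟨ cong (λ xs → sum (map f xs)) (upTo-∷ʳ m) ⟨
  sum (map f (upTo m ++ m ∷ []))       ≡⟨ cong sum (map-++ f (upTo m) (m ∷ [])) ⟩
  sum (map f (upTo m) ++ f m ∷ [])     ≡⟨ sum-++ (map f (upTo m)) (f m ∷ []) ⟩
  sum (map f (upTo m)) + (f m + 0)     ≡⟨ cong (sum (map f (upTo m)) +_) (+-identityʳ (f m)) ⟩
  sum (map f (upTo m)) + f m           ∎
  where open ≡-Reasoning

evenSum≡evens : ∀ n m → evenSum n m ≡ evens n m
evenSum≡evens n zero    = refl
evenSum≡evens n (suc m) = trans (sum-upTo-suc _ m) (cong (_+ (if isEven m then n C m else 0)) (evenSum≡evens n m))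

oddSum≡odds : ∀ n m → oddSum n m ≡ odds n m
oddSum≡odds n zero    = refl
oddSum≡odds n (suc m) = trans (sum-upTo-suc _ m) (cong (_+ (if isEven m then 0 else n C m)) (oddSum≡odds n m))

evens-pascal : ∀ n m → evens (suc n) (suc m) ≡ evens n (suc m) + odds n m
odds-pascal  : ∀ n m → odds (suc n) (suc m) ≡ odds n (suc m) + evens n m

evens-pascal n zero    = refl
evens-pascal n (suc m) rewrite evens-pascal n m | isEven-suc m with isEven m
... | true  = shuffle (evens n m + n C m) (odds n m)
  where
  shuffle : ∀ e o → e + o + 0 ≡ e + 0 + (o + 0)
  shuffle = solve-∀
... | false rewrite pascal n m = shuffle (evens n m) (odds n m) (n C m) (n C suc m)
  where
  shuffle : ∀ e o x y → e + 0 + o + (x + y) ≡ e + 0 + y + (o + x)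
  shuffle = solve-∀

odds-pascal n zero    = refl
odds-pascal n (suc m) rewrite odds-pascal n m | isEven-suc m with isEven m
... | true rewrite pascal n m = shuffle (odds n m) (evens n m) (n C m) (n C suc m)
  where
  shuffle : ∀ o e x y → o + 0 + e + (x + y) ≡ o + 0 + y + (e + x)
  shuffle = solve-∀
... | false = shuffle (odds n m + n C m) (evens n m)
  where
  shuffle : ∀ o e → o + e + 0 ≡ o + 0 + (e + 0)
  shuffle = solve-∀

evens-0 : ∀ m → evens 0 (suc m) ≡ 1
evens-0 zero    = refl
evens-0 (suc m) rewrite evens-0 m with isEven (suc m)
... | true  = refl
... | false = refl

odds-0 : ∀ m → odds 0 m ≡ 0
odds-0 zero          = refl
odds-0 (suc zero)    = refl
odds-0 (suc (suc m)) rewrite odds-0 (suc m) with isEven (suc m)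
... | true  = refl
... | false = refl

evens-stable : ∀ {n N} → n < N → evens n (suc N) ≡ evens n N
evens-stable {n} {N} n<N rewrite k>n⇒nCk≡0 n<N with isEven N
... | true  = +-identityʳ _
... | false = +-identityʳ _

odds-stable : ∀ {n N} → n < N → odds n (suc N) ≡ odds n N
odds-stable {n} {N} n<N rewrite k>n⇒nCk≡0 n<N with isEven N
... | true  = +-identityʳ _
... | false = +-identityʳ _

evens≡odds : ∀ {n N} → 0 < n → n < N → evens n N ≡ odds n N
evens≡odds {suc n} {suc N} _ (s≤s n<N) = begin
  evens (suc n) (suc N)       ≡⟨ evens-pascal n N ⟩
  evens n (suc N) + odds n N  ≡⟨ cong₂ _+_ (evens-stable n<N) (sym (odds-stable n<N)) ⟩
  evens n N + odds n (suc N)  ≡⟨ +-comm (evens n N) (odds n (suc N)) ⟩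
  odds n (suc N) + evens n N  ≡⟨ odds-pascal n N ⟨
  odds (suc n) (suc N)        ∎
  where open ≡-Reasoning

module Modulo (d : ℕ) where

  record _≈_ (x y : ℕ) : Set where
    constructor mod-≡
    field %-≡ : x % suc d ≡ y % suc d
  open _≈_ public

  infix 4 _≈_

  ≈-isEquivalence : IsEquivalence _≈_
  ≈-isEquivalence = record
    { refl  = mod-≡ refl
    ; sym   = λ (mod-≡ eq) → mod-≡ (sym eq)
    ; trans = λ (mod-≡ eq) (mod-≡ eq′) → mod-≡ (trans eq eq′)
    }

  ≈-setoid : Setoid _ _
  ≈-setoid = record { isEquivalence = ≈-isEquivalence }

  open IsEquivalence ≈-isEquivalence public
    using () renaming (refl to ≈-refl; sym to ≈-sym; trans to ≈-trans; reflexive to ≡⇒≈)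

  module ≈-Reasoning = SetoidReasoning ≈-setoid

  +-cong : ∀ {a b c e} → a ≈ b → c ≈ e → a + c ≈ b + e
  +-cong {a} {b} {c} {e} (mod-≡ a≈b) (mod-≡ c≈e) = mod-≡ (begin
    (a + c) % suc d                   ≡⟨ %-distribˡ-+ a c (suc d) ⟩
    (a % suc d + c % suc d) % suc d   ≡⟨ cong₂ (λ x y → (x + y) % suc d) a≈b c≈e ⟩
    (b % suc d + e % suc d) % suc d   ≡⟨ %-distribˡ-+ b e (suc d) ⟨
    (b + e) % suc d                   ∎)
    where open ≡-Reasoning

  *-cong : ∀ {a b c e} → a ≈ b → c ≈ e → a * c ≈ b * e
  *-cong {a} {b} {c} {e} (mod-≡ a≈b) (mod-≡ c≈e) = mod-≡ (begin
    (a * c) % suc d                   ≡⟨ %-distribˡ-* a c (suc d) ⟩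
    (a % suc d * (c % suc d)) % suc d ≡⟨ cong₂ (λ x y → (x * y) % suc d) a≈b c≈e ⟩
    (b % suc d * (e % suc d)) % suc d ≡⟨ %-distribˡ-* b e (suc d) ⟨
    (b * e) % suc d                   ∎)
    where open ≡-Reasoning

  ∣⇒≈0 : ∀ {x} → suc d ∣ x → x ≈ 0
  ∣⇒≈0 {x} p∣x = mod-≡ (n∣m⇒m%n≡0 x (suc d) p∣x)

  ≈0⇒∣ : ∀ {x} → x ≈ 0 → suc d ∣ x
  ≈0⇒∣ {x} (mod-≡ x≈0) = m%n≡0⇒n∣m x (suc d) x≈0

  -- Σ_{k<q} (-1)^k C(g,k) modulo p = 1 + d, with d standing for -1
  altSum : ℕ → ℕ → ℕ
  altSum q g = evens g q + d * odds g q

  altSum-0 : ∀ {q} → 0 < q → altSum q 0 ≡ 1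
  altSum-0 {suc q} _ rewrite evens-0 q | odds-0 (suc q) | *-zeroʳ d = refl

  altSum-below≈0 : ∀ {q g} → 0 < g → g < q → altSum q g ≈ 0
  altSum-below≈0 {q} {g} 0<g g<q = ∣⇒≈0 (divides (odds g q) (begin
    evens g q + d * odds g q  ≡⟨ cong (_+ d * odds g q) (evens≡odds 0<g g<q) ⟩
    odds g q + d * odds g q   ≡⟨ *-comm (suc d) (odds g q) ⟩
    odds g q * suc d          ∎))
    where open ≡-Reasoning

  if-cong : ∀ b {x y u v} → x ≈ y → u ≈ v → (if b then x else u) ≈ (if b then y else v)
  if-cong true  x≈y _   = x≈y
  if-cong false _   u≈v = u≈v

  module _ {q : ℕ} (p∣qC[1+k] : ∀ k → suc k < q → suc d ∣ q C suc k) where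

    C-periodic : ∀ n k → k < q → (n + q) C k ≈ n C k
    C-periodic n       zero    _   = ≈-refl
    C-periodic zero    (suc k) k<q = ∣⇒≈0 (p∣qC[1+k] k k<q)
    C-periodic (suc n) (suc k) k<q = begin
      suc (n + q) C suc k            ≡⟨ pascal (n + q) k ⟩
      (n + q) C k + (n + q) C suc k  ≈⟨ +-cong (C-periodic n k (<-trans (n<1+n k) k<q)) (C-periodic n (suc k) k<q) ⟩
      n C k + n C suc k              ≡⟨ pascal n k ⟨
      suc n C suc k                  ∎
      where open ≈-Reasoning

    evens-periodic : ∀ n N → N ≤ q → evens (n + q) N ≈ evens n N
    evens-periodic n zero    _   = ≈-refl
    evens-periodic n (suc N) N<q =
      +-cong (evens-periodic n N (<⇒≤ N<q)) (if-cong (isEven N) (C-periodic n N N<q) ≈-refl)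

    odds-periodic : ∀ n N → N ≤ q → odds (n + q) N ≈ odds n N
    odds-periodic n zero    _   = ≈-refl
    odds-periodic n (suc N) N<q =
      +-cong (odds-periodic n N (<⇒≤ N<q)) (if-cong (isEven N) ≈-refl (C-periodic n N N<q))

    altSum-periodic : ∀ r t → altSum q (r + t * q) ≈ altSum q r
    altSum-periodic r zero    = ≡⇒≈ (cong (altSum q) (+-identityʳ r))
    altSum-periodic r (suc t) = begin
      altSum q (r + (q + t * q))  ≡⟨ cong (altSum q) (reassoc r q (t * q)) ⟩
      altSum q (r + t * q + q)    ≈⟨ +-cong (evens-periodic (r + t * q) q ≤-refl) (*-cong (≈-refl {d}) (odds-periodic (r + t * q) q ≤-refl)) ⟩
      altSum q (r + t * q)        ≈⟨ altSum-periodic r t ⟩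
      altSum q r                  ∎
      where
      open ≈-Reasoning
      reassoc : ∀ a b c → a + (b + c) ≡ a + c + b
      reassoc = solve-∀

    ∤⇒altSum≈0 : .{{_ : NonZero q}} → ∀ {g} → ¬ (q ∣ g) → altSum q g ≈ 0
    ∤⇒altSum≈0 {g} q∤g = begin
      altSum q g                    ≡⟨ cong (altSum q) (m≡m%n+[m/n]*n g q) ⟩
      altSum q (g % q + g / q * q)  ≈⟨ altSum-periodic (g % q) (g / q) ⟩
      altSum q (g % q)              ≈⟨ altSum-below≈0 (n≢0⇒n>0 (λ g%q≡0 → q∤g (m%n≡0⇒n∣m g q g%q≡0))) (m%n<n g q) ⟩
      0                             ∎
      where open ≈-Reasoning

  sign : ℕ → ℕ
  sign k = if isEven k then 1 else d

  altSum-suc : ∀ q g → altSum (suc q) g ≡ altSum q g + sign q * (g C q)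
  altSum-suc q g with isEven q
  ... | true  = shuffle (evens g q) (odds g q) (g C q) d
    where
    shuffle : ∀ e o c d → e + c + d * (o + 0) ≡ e + d * o + 1 * c
    shuffle = solve-∀
  ... | false = shuffle (evens g q) (odds g q) (g C q) d
    where
    shuffle : ∀ e o c d → e + 0 + d * (o + c) ≡ e + d * o + d * c
    shuffle = solve-∀

  altSum≡binomials : ∀ q g → altSum q g ≡ sum (map (λ k → sign k * (g C k)) (upTo q))
  altSum≡binomials zero    g = *-zeroʳ d
  altSum≡binomials (suc q) g = begin
    altSum (suc q) g                                                ≡⟨ altSum-suc q g ⟩
    altSum q g + sign q * (g C q)                                   ≡⟨ cong (_+ sign q * (g C q)) (altSum≡binomials q g) ⟩
    sum (map (λ k → sign k * (g C k)) (upTo q)) + sign q * (g C q)  ≡⟨ sum-upTo-suc (λ k → sign k * (g C k)) q ⟨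
    sum (map (λ k → sign k * (g C k)) (upTo (suc q)))               ∎
    where open ≡-Reasoning

-- A polynomial in variables x_j ∈ {0,1} is a list of monomials x^J = ∏_{j∈J} x_j, each
-- repeated as often as its coefficient; monomial J I is the value of x^J at the indicator of I.
Poly : ℕ → Set
Poly n = List (Subset n)

monomial : Subset n → Subset n → ℕ
monomial []            []            = 1
monomial (outside ∷ J) (_       ∷ I) = monomial J I
monomial (inside  ∷ J) (outside ∷ I) = 0
monomial (inside  ∷ J) (inside  ∷ I) = monomial J I

eval : Poly n → Subset n → ℕ
eval []      I = 0
eval (J ∷ P) I = monomial J I + eval P I

monomial-∅ : (I : Subset n) → monomial ∅ I ≡ 1
monomial-∅ []      = refl
monomial-∅ (_ ∷ I) = monomial-∅ I

monomial-∪ : (J K I : Subset n) → monomial (J ∪ K) I ≡ monomial J I * monomial K I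
monomial-∪ [] [] [] = refl
monomial-∪ (outside ∷ J) (outside ∷ K) (_       ∷ I) = monomial-∪ J K I
monomial-∪ (outside ∷ J) (inside  ∷ K) (outside ∷ I) = sym (*-zeroʳ (monomial J I))
monomial-∪ (outside ∷ J) (inside  ∷ K) (inside  ∷ I) = monomial-∪ J K I
monomial-∪ (inside  ∷ J) (_       ∷ K) (outside ∷ I) = refl
monomial-∪ (inside  ∷ J) (outside ∷ K) (inside  ∷ I) = monomial-∪ J K I
monomial-∪ (inside  ∷ J) (inside  ∷ K) (inside  ∷ I) = monomial-∪ J K I

monomial≡0⊎1 : (J I : Subset n) → monomial J I ≡ 0 ⊎ monomial J I ≡ 1
monomial≡0⊎1 [] [] = inj₂ refl
monomial≡0⊎1 (outside ∷ J) (_       ∷ I) = monomial≡0⊎1 J I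
monomial≡0⊎1 (inside  ∷ J) (outside ∷ I) = inj₁ refl
monomial≡0⊎1 (inside  ∷ J) (inside  ∷ I) = monomial≡0⊎1 J I

one : Poly n
one = ∅ ∷ []

mul : Poly n → Poly n → Poly n
mul []      Q = []
mul (J ∷ P) Q = map (J ∪_) Q ++ mul P Q

scale : ℕ → Poly n → Poly n
scale zero    P = []
scale (suc c) P = P ++ scale c P

choose : ℕ → Poly n → Poly n
choose zero    P       = one
choose (suc k) []      = []
choose (suc k) (J ∷ P) = map (J ∪_) (choose k P) ++ choose (suc k) P

binomials : (ℕ → ℕ) → ℕ → Poly n → Poly n
binomials c zero    P = []
binomials c (suc N) P = binomials c N P ++ scale (c N) (choose N P)

prod : List (Poly n) → Poly n
prod = foldr mul one

eval-one : (I : Subset n) → eval one I ≡ 1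
eval-one I = cong (_+ 0) (monomial-∅ I)

eval-++ : ∀ (P Q : Poly n) I → eval (P ++ Q) I ≡ eval P I + eval Q I
eval-++ []      Q I = refl
eval-++ (J ∷ P) Q I = trans (cong (monomial J I +_) (eval-++ P Q I)) (sym (+-assoc (monomial J I) _ _))

eval-map-∪ : ∀ (J : Subset n) Q I → eval (map (J ∪_) Q) I ≡ monomial J I * eval Q I
eval-map-∪ J []      I = sym (*-zeroʳ (monomial J I))
eval-map-∪ J (K ∷ Q) I = begin
  monomial (J ∪ K) I + eval (map (J ∪_) Q) I            ≡⟨ cong₂ _+_ (monomial-∪ J K I) (eval-map-∪ J Q I) ⟩
  monomial J I * monomial K I + monomial J I * eval Q I  ≡⟨ *-distribˡ-+ (monomial J I) _ _ ⟨
  monomial J I * eval (K ∷ Q) I                          ∎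
  where open ≡-Reasoning

eval-mul : ∀ (P Q : Poly n) I → eval (mul P Q) I ≡ eval P I * eval Q I
eval-mul []      Q I = refl
eval-mul (J ∷ P) Q I = begin
  eval (map (J ∪_) Q ++ mul P Q) I              ≡⟨ eval-++ (map (J ∪_) Q) (mul P Q) I ⟩
  eval (map (J ∪_) Q) I + eval (mul P Q) I      ≡⟨ cong₂ _+_ (eval-map-∪ J Q I) (eval-mul P Q I) ⟩
  monomial J I * eval Q I + eval P I * eval Q I ≡⟨ *-distribʳ-+ (eval Q I) (monomial J I) (eval P I) ⟨
  eval (J ∷ P) I * eval Q I                     ∎
  where open ≡-Reasoning

eval-scale : ∀ c (P : Poly n) I → eval (scale c P) I ≡ c * eval P I
eval-scale zero    P I = refl
eval-scale (suc c) P I = trans (eval-++ P (scale c P) I) (cong (eval P I +_) (eval-scale c P I))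

eval-choose : ∀ k (P : Poly n) I → eval (choose k P) I ≡ eval P I C k
eval-choose zero    P       I = eval-one I
eval-choose (suc k) []      I = refl
eval-choose (suc k) (J ∷ P) I = begin
  eval (map (J ∪_) (choose k P) ++ choose (suc k) P) I          ≡⟨ eval-++ (map (J ∪_) (choose k P)) _ I ⟩
  eval (map (J ∪_) (choose k P)) I + eval (choose (suc k) P) I  ≡⟨ cong₂ _+_ (eval-map-∪ J (choose k P) I) (eval-choose (suc k) P I) ⟩
  monomial J I * eval (choose k P) I + eval P I C suc k         ≡⟨ cong (λ x → monomial J I * x + eval P I C suc k) (eval-choose k P I) ⟩
  monomial J I * (eval P I C k) + eval P I C suc k              ≡⟨ pascal-0⊎1 (monomial≡0⊎1 J I) ⟩
  (monomial J I + eval P I) C suc k                             ∎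
  where
  open ≡-Reasoning
  pascal-0⊎1 : ∀ {x} → x ≡ 0 ⊎ x ≡ 1 → x * (eval P I C k) + eval P I C suc k ≡ (x + eval P I) C suc k
  pascal-0⊎1 (inj₁ refl) = refl
  pascal-0⊎1 (inj₂ refl) = trans (cong (_+ eval P I C suc k) (*-identityˡ (eval P I C k))) (sym (pascal (eval P I) k))

eval-binomials : ∀ c N (P : Poly n) I → eval (binomials c N P) I ≡ sum (map (λ k → c k * (eval P I C k)) (upTo N))
eval-binomials c zero    P I = refl
eval-binomials c (suc N) P I = begin
  eval (binomials c N P ++ scale (c N) (choose N P)) I
    ≡⟨ eval-++ (binomials c N P) _ I ⟩
  eval (binomials c N P) I + eval (scale (c N) (choose N P)) I
    ≡⟨ cong₂ _+_ (eval-binomials c N P I) (trans (eval-scale (c N) (choose N P) I) (cong (c N *_) (eval-choose N P I))) ⟩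
  sum (map (λ k → c k * (eval P I C k)) (upTo N)) + c N * (eval P I C N)
    ≡⟨ sum-upTo-suc (λ k → c k * (eval P I C k)) N ⟨
  sum (map (λ k → c k * (eval P I C k)) (upTo (suc N)))
    ∎
  where open ≡-Reasoning

eval-prod : ∀ {X : Set} (F : X → Poly n) xs I → eval (prod (map F xs)) I ≡ product (map (λ x → eval (F x) I) xs)
eval-prod F []       I = eval-one I
eval-prod F (x ∷ xs) I = trans (eval-mul (F x) (prod (map F xs)) I) (cong (eval (F x) I *_) (eval-prod F xs I))

eval-in∷-in : ∀ (P : Poly n) I → eval (map (inside ∷_) P) (inside ∷ I) ≡ eval P I
eval-in∷-in []      I = refl
eval-in∷-in (J ∷ P) I = cong (monomial J I +_) (eval-in∷-in P I)

eval-in∷-out : ∀ (P : Poly n) I → eval (map (inside ∷_) P) (outside ∷ I) ≡ 0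
eval-in∷-out []      I = refl
eval-in∷-out (J ∷ P) I = eval-in∷-out P I

eval-out∷ : ∀ {s} (P : Poly n) I → eval (map (outside ∷_) P) (s ∷ I) ≡ eval P I
eval-out∷ []      I = refl
eval-out∷ (J ∷ P) I = cong (monomial J I +_) (eval-out∷ P I)

Deg : ℕ → Poly n → Set
Deg D P = All (λ J → ∣ J ∣ ≤ D) P

∣∪∣≤ : (J K : Subset n) → ∣ J ∪ K ∣ ≤ ∣ J ∣ + ∣ K ∣
∣∪∣≤ []            []            = z≤n
∣∪∣≤ (inside  ∷ J) (inside  ∷ K) = s≤s (≤-trans (∣∪∣≤ J K) (+-monoʳ-≤ ∣ J ∣ (n≤1+n ∣ K ∣)))
∣∪∣≤ (inside  ∷ J) (outside ∷ K) = s≤s (∣∪∣≤ J K)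
∣∪∣≤ (outside ∷ J) (inside  ∷ K) = subst (suc ∣ J ∪ K ∣ ≤_) (sym (+-suc ∣ J ∣ ∣ K ∣)) (s≤s (∣∪∣≤ J K))
∣∪∣≤ (outside ∷ J) (outside ∷ K) = ∣∪∣≤ J K

Deg-one : Deg a (one {n})
Deg-one {a = a} {n} = subst (_≤ a) (sym (∣⊥∣≡0 n)) z≤n ∷ []

Deg-mono : ∀ {P : Poly n} → a ≤ b → Deg a P → Deg b P
Deg-mono a≤b = All.map (λ ∣J∣≤a → ≤-trans ∣J∣≤a a≤b)

Deg-map-∪ : ∀ {J : Subset n} {Q} → ∣ J ∣ ≤ a → Deg b Q → Deg (a + b) (map (J ∪_) Q)
Deg-map-∪ {J = J} ∣J∣≤a =
  map⁺ ∘ All.map (λ {K} ∣K∣≤b → ≤-trans (∣∪∣≤ J K) (+-mono-≤ ∣J∣≤a ∣K∣≤b))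

Deg-mul : ∀ {P Q : Poly n} → Deg a P → Deg b Q → Deg (a + b) (mul P Q)
Deg-mul []           dQ = []
Deg-mul (∣J∣≤a ∷ dP) dQ = ++⁺ (Deg-map-∪ ∣J∣≤a dQ) (Deg-mul dP dQ)

Deg-scale : ∀ c {P : Poly n} → Deg a P → Deg a (scale c P)
Deg-scale zero    dP = []
Deg-scale (suc c) dP = ++⁺ dP (Deg-scale c dP)

Deg-choose : ∀ k {P : Poly n} → Deg a P → Deg (k * a) (choose k P)
Deg-choose zero    dP           = Deg-one
Deg-choose (suc k) []           = []
Deg-choose (suc k) (∣J∣≤a ∷ dP) = ++⁺ (Deg-map-∪ ∣J∣≤a (Deg-choose k dP)) (Deg-choose (suc k) dP)

Deg-binomials : ∀ c N {P : Poly n} → Deg a P → Deg ((N ∸ 1) * a) (binomials c N P)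
Deg-binomials c zero    dP = []
Deg-binomials {a = a} c (suc N) dP =
  ++⁺ (Deg-mono (*-monoˡ-≤ a (m∸n≤m N 1)) (Deg-binomials c N dP)) (Deg-scale (c N) (Deg-choose N dP))

Deg-prod : ∀ {X : Set} (D : X → ℕ) (F : X → Poly n) xs →
           (∀ x → Deg (D x) (F x)) → Deg (sum (map D xs)) (prod (map F xs))
Deg-prod D F []       dF = Deg-one
Deg-prod D F (x ∷ xs) dF = Deg-mul (dF x) (Deg-prod D F xs dF)

sumEven sumOdd : ∀ n → (Subset n → ℕ) → ℕ
sumEven zero    f = f []
sumEven (suc n) f = sumEven n (λ I → f (outside ∷ I)) + sumOdd n (λ I → f (inside ∷ I))
sumOdd  zero    f = 0
sumOdd  (suc n) f = sumOdd n (λ I → f (outside ∷ I)) + sumEven n (λ I → f (inside ∷ I))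

sumEven-+ : ∀ n (f g : Subset n → ℕ) → sumEven n (λ I → f I + g I) ≡ sumEven n f + sumEven n g
sumOdd-+  : ∀ n (f g : Subset n → ℕ) → sumOdd n (λ I → f I + g I) ≡ sumOdd n f + sumOdd n g
sumEven-+ zero    f g = refl
sumEven-+ (suc n) f g = trans
  (cong₂ _+_ (sumEven-+ n (λ I → f (outside ∷ I)) (λ I → g (outside ∷ I))) (sumOdd-+ n (λ I → f (inside ∷ I)) (λ I → g (inside ∷ I))))
  (interchange +-commutativeSemigroup (sumEven n (λ I → f (outside ∷ I))) _ _ _)
sumOdd-+  zero    f g = refl
sumOdd-+  (suc n) f g = trans
  (cong₂ _+_ (sumOdd-+ n (λ I → f (outside ∷ I)) (λ I → g (outside ∷ I))) (sumEven-+ n (λ I → f (inside ∷ I)) (λ I → g (inside ∷ I))))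
  (interchange +-commutativeSemigroup (sumOdd n (λ I → f (outside ∷ I))) _ _ _)

sumEven-0 : ∀ n → sumEven n (λ _ → 0) ≡ 0
sumOdd-0  : ∀ n → sumOdd n (λ _ → 0) ≡ 0
sumEven-0 zero    = refl
sumEven-0 (suc n) = cong₂ _+_ (sumEven-0 n) (sumOdd-0 n)
sumOdd-0  zero    = refl
sumOdd-0  (suc n) = cong₂ _+_ (sumOdd-0 n) (sumEven-0 n)

-- a monomial missing some variable x_j cancels against itself times x_j
monomial-sumEven≡sumOdd : ∀ n (J : Subset n) → ∣ J ∣ < n → sumEven n (monomial J) ≡ sumOdd n (monomial J)
monomial-sumEven≡sumOdd (suc n) (outside ∷ J) _ = +-comm (sumEven n (monomial J)) (sumOdd n (monomial J))
monomial-sumEven≡sumOdd (suc n) (inside ∷ J) (s≤s ∣J∣<n) = begin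
  sumEven n (λ _ → 0) + sumOdd n (monomial J)  ≡⟨ cong₂ _+_ (sumEven-0 n) (sym (monomial-sumEven≡sumOdd n J ∣J∣<n)) ⟩
  0 + sumEven n (monomial J)                   ≡⟨ cong (_+ sumEven n (monomial J)) (sumOdd-0 n) ⟨
  sumOdd n (λ _ → 0) + sumEven n (monomial J)  ∎
  where open ≡-Reasoning

Deg<n⇒sumEven≡sumOdd : ∀ n {D} (P : Poly n) → D < n → Deg D P → sumEven n (eval P) ≡ sumOdd n (eval P)
Deg<n⇒sumEven≡sumOdd n []      _   []           = trans (sumEven-0 n) (sym (sumOdd-0 n))
Deg<n⇒sumEven≡sumOdd n (J ∷ P) D<n (∣J∣≤D ∷ dP) = begin
  sumEven n (λ I → monomial J I + eval P I)       ≡⟨ sumEven-+ n (monomial J) (eval P) ⟩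
  sumEven n (monomial J) + sumEven n (eval P)     ≡⟨ cong₂ _+_ (monomial-sumEven≡sumOdd n J (≤-<-trans ∣J∣≤D D<n)) (Deg<n⇒sumEven≡sumOdd n P D<n dP) ⟩
  sumOdd n (monomial J) + sumOdd n (eval P)       ≡⟨ sumOdd-+ n (monomial J) (eval P) ⟨
  sumOdd n (λ I → monomial J I + eval P I)        ∎
  where open ≡-Reasoning

below : ℕ → Subset n → ℕ
below m I = if ∣ I ∣ <ᵇ m then 1 else 0

below-< : ∀ {n m} {I : Subset n} → ∣ I ∣ < m → below m I ≡ 1
below-< {m = m} {I} ∣I∣<m with ∣ I ∣ <ᵇ m | <⇒<ᵇ ∣I∣<m
... | true | _ = refl

below-≥ : ∀ {n m} {I : Subset n} → m ≤ ∣ I ∣ → below m I ≡ 0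
below-≥ {m = m} {I} m≤∣I∣ with ∣ I ∣ <ᵇ m | <ᵇ⇒< ∣ I ∣ m
... | false | _       = refl
... | true  | T⇒∣I∣<m = contradiction (T⇒∣I∣<m _) (≤⇒≯ m≤∣I∣)

sumEven-below : ∀ n m → sumEven n (below m) ≡ evens n m
sumOdd-below  : ∀ n m → sumOdd n (below m) ≡ odds n m
sumEven-below zero    zero    = refl
sumEven-below zero    (suc m) = sym (evens-0 m)
sumEven-below (suc n) zero    = cong₂ _+_ (sumEven-0 n) (sumOdd-0 n)
sumEven-below (suc n) (suc m) = trans (cong₂ _+_ (sumEven-below n (suc m)) (sumOdd-below n m)) (sym (evens-pascal n m))
sumOdd-below  zero    m       = sym (odds-0 m)
sumOdd-below  (suc n) zero    = cong₂ _+_ (sumOdd-0 n) (sumEven-0 n)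
sumOdd-below  (suc n) (suc m) = trans (cong₂ _+_ (sumOdd-below n (suc m)) (sumEven-below n m)) (sym (odds-pascal n m))

module _ (d : ℕ) where
  open Modulo d

  sumEven-≈ : ∀ n {f g : Subset n → ℕ} → (∀ I → f I ≈ g I) → sumEven n f ≈ sumEven n g
  sumOdd-≈  : ∀ n {f g : Subset n → ℕ} → (∀ I → f I ≈ g I) → sumOdd n f ≈ sumOdd n g
  sumEven-≈ zero    f≈g = f≈g []
  sumEven-≈ (suc n) f≈g = +-cong (sumEven-≈ n (λ I → f≈g (outside ∷ I))) (sumOdd-≈ n (λ I → f≈g (inside ∷ I)))
  sumOdd-≈  zero    f≈g = ≈-refl
  sumOdd-≈  (suc n) f≈g = +-cong (sumOdd-≈ n (λ I → f≈g (outside ∷ I))) (sumEven-≈ n (λ I → f≈g (inside ∷ I)))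

esym-short : ∀ m xs → length xs < m → esym m xs ≡ 0
esym-short (suc m) []       _            = refl
esym-short (suc m) (x ∷ xs) (s≤s ∣xs∣<m)
  rewrite esym-short m xs ∣xs∣<m | esym-short (suc m) xs (m<n⇒m<1+n ∣xs∣<m) = trans (+-identityʳ (x * 0)) (*-zeroʳ x)

module _ {X : Set} where

  select : (S : List X) → Subset (length S) → List X
  select []      []            = []
  select (x ∷ S) (inside  ∷ I) = x ∷ select S I
  select (x ∷ S) (outside ∷ I) = select S I

  length-select : ∀ S I → length (select S I) ≡ ∣ I ∣
  length-select []      []            = refl
  length-select (x ∷ S) (inside  ∷ I) = cong suc (length-select S I)
  length-select (x ∷ S) (outside ∷ I) = length-select S I

  select-⊆ : ∀ S I → select S I ⊆ S
  select-⊆ []      []            = []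
  select-⊆ (x ∷ S) (inside  ∷ I) = refl ∷ select-⊆ S I
  select-⊆ (x ∷ S) (outside ∷ I) = x ∷ʳ select-⊆ S I

  -- e_m(v x₁ · t₁, …, v x_ℓ · t_ℓ) for S = x₁ … x_ℓ, as a polynomial in the indicator variables t_j
  esymPoly : (X → ℕ) → ℕ → (S : List X) → Poly (length S)
  esymPoly v zero    S       = one
  esymPoly v (suc m) []      = []
  esymPoly v (suc m) (x ∷ S) =
    scale (v x) (map (inside ∷_) (esymPoly v m S)) ++ map (outside ∷_) (esymPoly v (suc m) S)

  eval-esymPoly : ∀ v m S I → eval (esymPoly v m S) I ≡ esym m (map v (select S I))
  eval-esymPoly v zero    S       I             = eval-one I
  eval-esymPoly v (suc m) []      []            = refl
  eval-esymPoly v (suc m) (x ∷ S) (inside ∷ I)  = begin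
    eval (scale (v x) (map (inside ∷_) (esymPoly v m S)) ++ map (outside ∷_) (esymPoly v (suc m) S)) (inside ∷ I)
      ≡⟨ eval-++ (scale (v x) _) (map (outside ∷_) (esymPoly v (suc m) S)) (inside ∷ I) ⟩
    eval (scale (v x) (map (inside ∷_) (esymPoly v m S))) (inside ∷ I) + eval (map (outside ∷_) (esymPoly v (suc m) S)) (inside ∷ I)
      ≡⟨ cong₂ _+_ (trans (eval-scale (v x) _ (inside ∷ I)) (cong (v x *_) (eval-in∷-in (esymPoly v m S) I))) (eval-out∷ (esymPoly v (suc m) S) I) ⟩
    v x * eval (esymPoly v m S) I + eval (esymPoly v (suc m) S) I
      ≡⟨ cong₂ (λ a b → v x * a + b) (eval-esymPoly v m S I) (eval-esymPoly v (suc m) S I) ⟩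
    esym (suc m) (map v (x ∷ select S I))
      ∎
    where open ≡-Reasoning
  eval-esymPoly v (suc m) (x ∷ S) (outside ∷ I) = begin
    eval (scale (v x) (map (inside ∷_) (esymPoly v m S)) ++ map (outside ∷_) (esymPoly v (suc m) S)) (outside ∷ I)
      ≡⟨ eval-++ (scale (v x) _) (map (outside ∷_) (esymPoly v (suc m) S)) (outside ∷ I) ⟩
    eval (scale (v x) (map (inside ∷_) (esymPoly v m S))) (outside ∷ I) + eval (map (outside ∷_) (esymPoly v (suc m) S)) (outside ∷ I)
      ≡⟨ cong₂ _+_ (trans (eval-scale (v x) _ (outside ∷ I)) (trans (cong (v x *_) (eval-in∷-out (esymPoly v m S) I)) (*-zeroʳ (v x)))) (eval-out∷ (esymPoly v (suc m) S) I) ⟩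
    eval (esymPoly v (suc m) S) I
      ≡⟨ eval-esymPoly v (suc m) S I ⟩
    esym (suc m) (map v (select S I))
      ∎
    where open ≡-Reasoning

  Deg-esymPoly : ∀ v m S → Deg m (esymPoly v m S)
  Deg-esymPoly v zero    S       = Deg-one
  Deg-esymPoly v (suc m) []      = []
  Deg-esymPoly v (suc m) (x ∷ S) =
    ++⁺ (Deg-scale (v x) (map⁺ (All.map s≤s (Deg-esymPoly v m S)))) (map⁺ (Deg-esymPoly v (suc m) S))

product-map-1 : ∀ {X : Set} (f : X → ℕ) xs → (∀ x → f x ≡ 1) → product (map f xs) ≡ 1
product-map-1 f []       _    = refl
product-map-1 f (x ∷ xs) f≡1 = cong₂ _*_ (f≡1 x) (product-map-1 f xs f≡1)

sum-map-*ʳ : ∀ {X : Set} (f : X → ℕ) c xs → sum (map (λ x → f x * c) xs) ≡ sum (map f xs) * c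
sum-map-*ʳ f c []       = refl
sum-map-*ʳ f c (x ∷ xs) = trans (cong (f x * c +_) (sum-map-*ʳ f c xs)) (sym (*-distribʳ-+ c (f x) _))

EmZero? : ∀ p r α m S → Dec (EmZero p r α m S)
EmZero? p r α m S = all? (λ i → p ^ α i ∣? esym m (map (λ a → toℕ (a i)) S))

module _ {d r : ℕ} (α : Fin r → ℕ) (p-prime : Prime (suc d)) (m : ℕ) (T : List (Elem (suc d) r α)) where
  open Modulo d

  private
    q : Fin r → ℕ
    q i = suc d ^ α i

    coord : Fin r → Elem (suc d) r α → ℕ
    coord i a = toℕ (a i)

    emCoord : Fin r → Subset (length T) → ℕ
    emCoord i I = esym m (map (coord i) (select T I))

    factor : Fin r → Poly (length T)
    factor i = binomials sign (q i) (esymPoly (coord i) m T)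

  chevalleyPoly : Poly (length T)
  chevalleyPoly = prod (map factor (allFin r))

  eval-chevalleyPoly : ∀ I → eval chevalleyPoly I ≡ product (map (λ i → altSum (q i) (emCoord i I)) (allFin r))
  eval-chevalleyPoly I = trans (eval-prod factor (allFin r) I) (cong product (map-cong eval-factor (allFin r)))
    where
    eval-factor : ∀ i → eval (factor i) I ≡ altSum (q i) (emCoord i I)
    eval-factor i = begin
      eval (factor i) I                                                ≡⟨ eval-binomials sign (q i) _ I ⟩
      sum (map (λ k → sign k * (eval (esymPoly (coord i) m T) I C k)) (upTo (q i)))
        ≡⟨ cong (λ g → sum (map (λ k → sign k * (g C k)) (upTo (q i)))) (eval-esymPoly (coord i) m T I) ⟩
      sum (map (λ k → sign k * (emCoord i I C k)) (upTo (q i)))       ≡⟨ altSum≡binomials (q i) (emCoord i I) ⟨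
      altSum (q i) (emCoord i I)                                       ∎
      where open ≡-Reasoning

  Deg-chevalleyPoly : Deg (m * sum (map (λ i → q i ∸ 1) (allFin r))) chevalleyPoly
  Deg-chevalleyPoly =
    subst (λ D → Deg D chevalleyPoly) (trans (sum-map-*ʳ (λ i → q i ∸ 1) m (allFin r)) (*-comm _ m))
          (Deg-prod (λ i → (q i ∸ 1) * m) factor (allFin r) (λ i → Deg-binomials sign (q i) (Deg-esymPoly (coord i) m T)))

  eval-chevalleyPoly≈below : (∀ I → m ≤ ∣ I ∣ → ¬ EmZero (suc d) r α m (select T I)) →
                             ∀ I → eval chevalleyPoly I ≈ below m I
  eval-chevalleyPoly≈below noZero I with m ≤? ∣ I ∣
  ... | no m≰∣I∣ = ≡⇒≈ (begin
    eval chevalleyPoly I                                           ≡⟨ eval-chevalleyPoly I ⟩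
    product (map (λ i → altSum (q i) (emCoord i I)) (allFin r))    ≡⟨ product-map-1 _ (allFin r) altSum≡1 ⟩
    1                                                              ≡⟨ below-< {I = I} (≰⇒> m≰∣I∣) ⟨
    below m I                                                      ∎)
    where
    open ≡-Reasoning
    altSum≡1 : ∀ i → altSum (q i) (emCoord i I) ≡ 1
    altSum≡1 i = begin
      altSum (q i) (emCoord i I) ≡⟨ cong (altSum (q i)) (esym-short m (map (coord i) (select T I)) ∣T_I∣<m) ⟩
      altSum (q i) 0             ≡⟨ altSum-0 (m^n>0 (suc d) (α i)) ⟩
      1                          ∎
      where
      ∣T_I∣<m : length (map (coord i) (select T I)) < m
      ∣T_I∣<m = subst (_< m) (sym (trans (length-map (coord i) (select T I)) (length-select T I))) (≰⇒> m≰∣I∣)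
  ... | yes m≤∣I∣ with ¬∀⟶∃¬ r _ (λ i → q i ∣? emCoord i I) (noZero I m≤∣I∣)
  ...   | i , q∤emCoord = begin
    eval chevalleyPoly I                                           ≡⟨ eval-chevalleyPoly I ⟩
    product (map (λ i → altSum (q i) (emCoord i I)) (allFin r))    ≈⟨ ∣⇒≈0 (∣-trans p∣factor (∈⇒∣product (∈-map⁺ _ (∈-allFin i)))) ⟩
    0                                                              ≡⟨ below-≥ {I = I} m≤∣I∣ ⟨
    below m I                                                      ∎
    where
    open ≈-Reasoning
    instance
      q≢0 : NonZero (q i)
      q≢0 = m^n≢0 (suc d) (α i)
    p∣factor : suc d ∣ altSum (q i) (emCoord i I)
    p∣factor = ≈0⇒∣ (∤⇒altSum≈0 (λ k → p∣[p^a]C[1+k] p-prime (α i) k) q∤emCoord)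

  no-zero-subsequence⇒evens≈odds :
    (∀ I → m ≤ ∣ I ∣ → ¬ EmZero (suc d) r α m (select T I)) →
    ULower (suc d) r α m ≤ length T →
    evens (length T) m ≈ odds (length T) m
  no-zero-subsequence⇒evens≈odds noZero ULower≤ℓ = begin
    evens ℓ m                       ≡⟨ sumEven-below ℓ m ⟨
    sumEven ℓ (below m)             ≈⟨ sumEven-≈ d ℓ (λ I → ≈-sym (F≈below I)) ⟩
    sumEven ℓ (eval chevalleyPoly)  ≡⟨ Deg<n⇒sumEven≡sumOdd ℓ chevalleyPoly deg<ℓ Deg-chevalleyPoly ⟩
    sumOdd ℓ (eval chevalleyPoly)   ≈⟨ sumOdd-≈ d ℓ F≈below ⟩
    sumOdd ℓ (below m)              ≡⟨ sumOdd-below ℓ m ⟩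
    odds ℓ m                        ∎
    where
    open ≈-Reasoning
    ℓ = length T
    F≈below = eval-chevalleyPoly≈below noZero
    deg<ℓ : m * sum (map (λ i → q i ∸ 1) (allFin r)) < ℓ
    deg<ℓ = subst (_≤ ℓ) (+-comm _ 1) ULower≤ℓ

UCond⇒DmBound : ∀ {d r} (α : Fin r → ℕ) m U → Prime (suc d) → UCond (suc d) r α m U → DmBound (suc d) r α m U
UCond⇒DmBound {d} {r} α m U p-prime (ULower≤U , evenSum≉oddSum) S U≤∣S∣
  with anySubset? (λ I → m ≤? ∣ I ∣ ×-dec EmZero? (suc d) r α m (select (take U S) I))
... | yes (I , m≤∣I∣ , emZero) =
  select (take U S) I , ⊆-trans (select-⊆ (take U S) I) (take-⊆ U S) ,
  subst (m ≤_) (sym (length-select (take U S) I)) m≤∣I∣ , emZero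
... | no ∄I = contradiction (%-≡ evenSum≈oddSum) evenSum≉oddSum
  where
  open Modulo d
  ∣T∣≡U : length (take U S) ≡ U
  ∣T∣≡U = trans (length-take U S) (m≤n⇒m⊓n≡m U≤∣S∣)
  evens≈odds : evens (length (take U S)) m ≈ odds (length (take U S)) m
  evens≈odds = no-zero-subsequence⇒evens≈odds α p-prime m (take U S)
    (λ I m≤∣I∣ emZero → ∄I (I , m≤∣I∣ , emZero)) (subst (ULower (suc d) r α m ≤_) (sym ∣T∣≡U) ULower≤U)
  evenSum≈oddSum : evenSum U m ≈ oddSum U m
  evenSum≈oddSum = subst (λ ℓ → evenSum ℓ m ≈ oddSum ℓ m) ∣T∣≡U
    (subst₂ _≈_ (sym (evenSum≡evens _ m)) (sym (oddSum≡odds _ m)) evens≈odds)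

theorem9 : (p r : ℕ) (α : Fin r → ℕ) (m U : ℕ) →
           Prime p → 1 ≤ r → ((i : Fin r) → 1 ≤ α i) → 1 ≤ m →
           IsU p r α m U →
           DmBound p r α m U
theorem9 zero    r α m U p-prime _ _ _ _            = contradiction p-prime ¬prime[0]
theorem9 (suc d) r α m U p-prime _ _ _ (U-cond , _) = UCond⇒DmBound α m U p-prime U-cond
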